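{- Let $m,D,N$ be positive integers, and let $a_1,\dots,a_m\in\mathbb{Z}$ with $\gcd(a_1,\dots,a_m,D)=1$. Then the set \[ I=\{(i_1,\dots,i_m)\in\mathbb{Z}^m\,;\,1\le i_1,\dots,i_m\le N\ \text{and}\ \gcd(a_1i_1+\cdots+a_mi_m,D)=1\} \] has cardinality \[ |I|=N^m\prod_{p\mid D}\Big(1-\frac1p\Big)+E\quad\text{with}\quad|E|\le 2^{\omega(D)}(3N)^{m-1}, \] where the product runs over the prime divisors $p$ of $D$ and $\omega(D)$ is the number of distinct prime divisors of $D$. -}

module Defs where

open import Data.Nat as ℕ using (ℕ; zero; suc)
open import Data.Nat.Divisibility using (_∣?_)
open import Data.Nat.Primality using (prime?)
open import Data.Integer as ℤ using (ℤ; +_)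
open import Data.Integer.GCD using (gcd)
open import Data.Rational as ℚ using (ℚ; 0ℚ; 1ℚ)
open import Data.List using (List; []; _∷_; map; concatMap; upTo; filter; length; foldr)
open import Data.Vec as Vec using (Vec; []; _∷_)
open import Relation.Nullary.Decidable using (_×-dec_)
open import Relation.Binary.PropositionalEquality using (_≡_)

gcdAll : ∀ {m} → Vec ℤ m → ℤ → ℤ
gcdAll a d = Vec.foldr _ gcd d a

box : (m N : ℕ) → List (Vec ℤ m)
box zero    N = [] ∷ []
box (suc m) N = concatMap (λ i → map (i ∷_) (box m N)) (map (λ k → + suc k) (upTo N))

dot : ∀ {m} → Vec ℤ m → Vec ℤ m → ℤ
dot []      []      = + 0
dot (a ∷ as) (i ∷ is) = a ℤ.* i ℤ.+ dot as is

-- the set I as a list (without repetitions)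
I : ∀ {m} (D N : ℕ) → Vec ℤ m → List (Vec ℤ m)
I {m} D N a = filter (λ i → gcd (dot a i) (+ D) ℤ.≟ + 1) (box m N)

-- the prime divisors of D (for D ≥ 1 they all lie in [0, D])
primeDivisors : ℕ → List ℕ
primeDivisors D = filter (λ p → prime? p ×-dec p ∣? D) (upTo (suc D))

ω : ℕ → ℕ
ω D = length (primeDivisors D)

-- 1/p as a rational (p = 0 never occurs for primes; mapped to 0)
recip : ℕ → ℚ
recip zero    = 0ℚ
recip (suc n) = + 1 ℚ./ suc n

eulerProduct : ℕ → ℚ
eulerProduct D = foldr (λ p acc → (1ℚ ℚ.- recip p) ℚ.* acc) 1ℚ (primeDivisors D)

toℚ : ℕ → ℚ
toℚ n = + n ℚ./ 1

{-# OPTIONS --safe #-}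

-- For d ∣ D let T_d count the points x of the box with d ∣ a·x.  With x₂,…,xₘ fixed,
-- the congruence a₁x₁ + s ≡ 0 (mod d) is unsolvable unless g = gcd(a₁, d) divides s,
-- and otherwise its solutions form one residue class modulo d/g; so every line in
-- the x₁-direction meets it g·N/d·[g ∣ s] times up to an error of 1.  As (a₂,…,aₘ) is
-- coprime to g, induction on m gives |d·T_d − N^m| ≤ d·m·N^(m−1).  Removing the
-- multiples of the primes p ∣ D one at a time (the count at level d splits into the
-- part prime to p and the count at level d·p) multiplies the main term by 1 − 1/p and
-- at most doubles the error, which ends at 2^ω(D)·m·N^(m−1) ≤ 2^ω(D)·(3N)^(m−1).

module Submission where

open import Level using (Level)
open import Data.Nat as ℕ using (ℕ; zero; suc; _+_; _*_; _^_; _∸_; _≤_; _<_; z≤n; s≤s; NonZero; pred; ∣_-_∣; _%_; _/_)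
open import Data.Nat.Properties
open import Data.Nat.DivMod using (m≡m%n+[m/n]*n; m%n<n; m*[n/m]≡n; m/n*n≡m)
open import Data.Nat.Tactic.RingSolver using (solve-∀)
open import Data.List using (List; []; _∷_; _++_; _∷ʳ_; map; concatMap; upTo; filter; length; foldr)
open import Data.List.Properties using (upTo-∷ʳ; length-upTo)
open import Data.Product using (∃; ∃-syntax; _×_; _,_; proj₁; proj₂; uncurry)
open import Data.Sum using (inj₁; inj₂)
open import Function using (_∘_; _⇔_; mk⇔; Equivalence)
open import Relation.Nullary using (Dec; yes; no; ¬_; ¬?; contradiction)
open import Relation.Nullary.Decidable using (_×-dec_)
open import Relation.Unary using (Pred; Decidable)
open import Relation.Binary.PropositionalEquality

private
  variable
    ℓ ℓ′ : Level
    A : Set ℓ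

indicator : {P : Set ℓ} → Dec P → ℕ
indicator (yes _) = 1
indicator (no _)  = 0

indicator-cong : {P : Set ℓ} {Q : Set ℓ′} (P? : Dec P) (Q? : Dec Q) → P ⇔ Q →
                 indicator P? ≡ indicator Q?
indicator-cong (yes _) (yes _) _   = refl
indicator-cong (no _)  (no _)  _   = refl
indicator-cong (yes p) (no ¬q) P⇔Q = contradiction (Equivalence.to P⇔Q p) ¬q
indicator-cong (no ¬p) (yes q) P⇔Q = contradiction (Equivalence.from P⇔Q q) ¬p

indicator-split : {P : Set ℓ} {Q : Set ℓ′} (P? : Dec P) (Q? : Dec Q) →
                  indicator P? ≡ indicator (P? ×-dec ¬? Q?) + indicator (P? ×-dec Q?)
indicator-split (yes _) (yes _) = refl
indicator-split (yes _) (no _)  = refl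
indicator-split (no _)  _       = refl

sumBy : (A → ℕ) → List A → ℕ
sumBy f []       = 0
sumBy f (x ∷ xs) = f x + sumBy f xs

module _ {A : Set ℓ} where

  sumBy-++ : ∀ (f : A → ℕ) xs ys → sumBy f (xs ++ ys) ≡ sumBy f xs + sumBy f ys
  sumBy-++ f []       ys = refl
  sumBy-++ f (x ∷ xs) ys = trans (cong (f x +_) (sumBy-++ f xs ys)) (sym (+-assoc (f x) _ _))

  sumBy-cong : ∀ {f g : A → ℕ} → (∀ x → f x ≡ g x) → ∀ xs → sumBy f xs ≡ sumBy g xs
  sumBy-cong f≗g []       = refl
  sumBy-cong f≗g (x ∷ xs) = cong₂ _+_ (f≗g x) (sumBy-cong f≗g xs)

  sumBy-+ : ∀ (f g : A → ℕ) xs → sumBy (λ x → f x + g x) xs ≡ sumBy f xs + sumBy g xs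
  sumBy-+ f g []       = refl
  sumBy-+ f g (x ∷ xs) = trans (cong (f x + g x +_) (sumBy-+ f g xs)) (+-+-interchange (f x) (g x) _ _)
    where
    +-+-interchange : ∀ a b c d → (a + b) + (c + d) ≡ (a + c) + (b + d)
    +-+-interchange = solve-∀

  *-sumBy : ∀ c (f : A → ℕ) xs → c * sumBy f xs ≡ sumBy (λ x → c * f x) xs
  *-sumBy c f []       = *-zeroʳ c
  *-sumBy c f (x ∷ xs) = trans (*-distribˡ-+ c (f x) _) (cong (c * f x +_) (*-sumBy c f xs))

  sumBy-const : ∀ c (xs : List A) → sumBy (λ _ → c) xs ≡ c * length xs
  sumBy-const c []       = sym (*-zeroʳ c)
  sumBy-const c (x ∷ xs) = trans (cong (c +_) (sumBy-const c xs)) (sym (*-suc c (length xs)))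

module _ {A : Set ℓ} {B : Set ℓ′} where

  sumBy-map : ∀ (f : B → ℕ) (h : A → B) xs → sumBy f (map h xs) ≡ sumBy (f ∘ h) xs
  sumBy-map f h []       = refl
  sumBy-map f h (x ∷ xs) = cong (f (h x) +_) (sumBy-map f h xs)

  sumBy-concatMap : ∀ (f : B → ℕ) (h : A → List B) xs →
                    sumBy f (concatMap h xs) ≡ sumBy (sumBy f ∘ h) xs
  sumBy-concatMap f h []       = refl
  sumBy-concatMap f h (x ∷ xs) =
    trans (sumBy-++ f (h x) (concatMap h xs)) (cong (sumBy f (h x) +_) (sumBy-concatMap f h xs))

  sumBy-comm : ∀ (f : A → B → ℕ) xs ys →
               sumBy (λ x → sumBy (f x) ys) xs ≡ sumBy (λ y → sumBy (λ x → f x y) xs) ys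
  sumBy-comm f []       ys = sym (sumBy-const 0 ys)
  sumBy-comm f (x ∷ xs) ys =
    trans (cong (sumBy (f x) ys +_) (sumBy-comm f xs ys)) (sym (sumBy-+ (f x) _ ys))

count : {P : Pred A ℓ′} → Decidable P → List A → ℕ
count P? = sumBy (indicator ∘ P?)

length-filter≡count : {P : Pred A ℓ′} (P? : Decidable P) → ∀ xs → length (filter P? xs) ≡ count P? xs
length-filter≡count P? []       = refl
length-filter≡count P? (x ∷ xs) with P? x
... | yes _ = cong suc (length-filter≡count P? xs)
... | no _  = length-filter≡count P? xs

countBelow : {P : Pred ℕ ℓ} → Decidable P → ℕ → ℕ
countBelow P? n = count P? (upTo n)

module _ {P : Pred ℕ ℓ} (P? : Decidable P) where

  countBelow-suc : ∀ n → countBelow P? (suc n) ≡ countBelow P? n + indicator (P? n)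
  countBelow-suc n = begin
    count P? (upTo (suc n))   ≡⟨ cong (count P?) (upTo-∷ʳ n) ⟨
    count P? (upTo n ∷ʳ n)     ≡⟨ sumBy-++ (indicator ∘ P?) (upTo n) (n ∷ []) ⟩
    countBelow P? n + (indicator (P? n) + 0) ≡⟨ cong (countBelow P? n +_) (+-identityʳ _) ⟩
    countBelow P? n + indicator (P? n) ∎
    where open ≡-Reasoning

  countBelow-mono : ∀ {m n} → m ≤ n → countBelow P? m ≤ countBelow P? n
  countBelow-mono {n = zero}  z≤n = ≤-refl
  countBelow-mono {m} {suc n} m≤1+n with m≤n⇒m<n∨m≡n m≤1+n
  ... | inj₂ refl = ≤-refl
  ... | inj₁ m<1+n = begin
    countBelow P? m                          ≤⟨ countBelow-mono (ℕ.s≤s⁻¹ m<1+n) ⟩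
    countBelow P? n                          ≤⟨ m≤m+n _ _ ⟩
    countBelow P? n + indicator (P? n)       ≡⟨ countBelow-suc n ⟨
    countBelow P? (suc n)                    ∎
    where open ≤-Reasoning

  countBelow-≡0 : ∀ n → (∀ k → k < n → ¬ P k) → countBelow P? n ≡ 0
  countBelow-≡0 zero    _    = refl
  countBelow-≡0 (suc n) none with P? n | countBelow-suc n
  ... | yes Pn | _  = contradiction Pn (none n ≤-refl)
  ... | no _   | eq = trans eq (trans (+-identityʳ _) (countBelow-≡0 n (λ k k<n → none k (m<n⇒m<1+n k<n))))

  countBelow-≡1 : ∀ {r} n → r < n → P r → (∀ k → k < n → P k → k ≡ r) → countBelow P? n ≡ 1
  countBelow-≡1 {r} (suc n) r<1+n Pr only with m<1+n⇒m<n∨m≡n r<1+n | P? n | countBelow-suc n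
  ... | inj₁ r<n  | yes Pn | _  = contradiction (only n ≤-refl Pn) (<⇒≢ r<n ∘ sym)
  ... | inj₁ r<n  | no _   | eq = trans eq (trans (+-identityʳ _)
                                    (countBelow-≡1 n r<n Pr (λ k k<n → only k (m<n⇒m<1+n k<n))))
  ... | inj₂ refl | no ¬Pr | _  = contradiction Pr ¬Pr
  ... | inj₂ refl | yes _  | eq = trans eq (cong (_+ 1) (countBelow-≡0 r none))
    where
    none : ∀ k → k < r → ¬ P k
    none k k<r Pk = <⇒≢ k<r (only k (m<n⇒m<1+n k<r) Pk)

infix 4 _≈[_]_

_≈[_]_ : ℕ → ℕ → ℕ → Set
x ≈[ c ] y = x ≤ y + c × y ≤ x + c

≈-refl : ∀ {x c} → x ≈[ c ] x
≈-refl {x} {c} = m≤m+n x c , m≤m+n x c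

≈-cong : ∀ {x x′ c c′ y y′} → x ≡ x′ → c ≡ c′ → y ≡ y′ → x ≈[ c ] y → x′ ≈[ c′ ] y′
≈-cong refl refl refl x≈y = x≈y

module _ {x y c : ℕ} where

  ≈-sym : x ≈[ c ] y → y ≈[ c ] x
  ≈-sym (x≤ , y≤) = y≤ , x≤

  ≈-weaken : ∀ {c′} → c ≤ c′ → x ≈[ c ] y → x ≈[ c′ ] y
  ≈-weaken c≤c′ (x≤ , y≤) = ≤-trans x≤ (+-monoʳ-≤ y c≤c′) , ≤-trans y≤ (+-monoʳ-≤ x c≤c′)

  *-≈ : ∀ k → x ≈[ c ] y → k * x ≈[ k * c ] k * y
  *-≈ k (x≤ , y≤) = bound x≤ , bound y≤
    where
    bound : ∀ {u v} → u ≤ v + c → k * u ≤ k * v + k * c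
    bound {v = v} u≤ = ≤-trans (*-monoʳ-≤ k u≤) (≤-reflexive (*-distribˡ-+ k v c))

  ≈-trans : ∀ {z c′} → x ≈[ c ] y → y ≈[ c′ ] z → x ≈[ c + c′ ] z
  ≈-trans {z} {c′} (x≤ , y≤) (y≤′ , z≤) =
    ≤-trans x≤ (≤-trans (+-monoˡ-≤ c y≤′) (≤-reflexive (shuffle z c′ c))) ,
    ≤-trans z≤ (≤-trans (+-monoˡ-≤ c′ y≤) (≤-reflexive (+-assoc x c c′)))
    where
    shuffle : ∀ a b d → (a + b) + d ≡ a + (d + b)
    shuffle = solve-∀

  +-≈ : ∀ {x′ y′ c′} → x ≈[ c ] y → x′ ≈[ c′ ] y′ → x + x′ ≈[ c + c′ ] y + y′
  +-≈ {x′} {y′} {c′} (x≤ , y≤) (x′≤ , y′≤) = bound x≤ x′≤ , bound y≤ y′≤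
    where
    bound : ∀ {u u′ v v′} → u ≤ v + c → u′ ≤ v′ + c′ → u + u′ ≤ (v + v′) + (c + c′)
    bound {v = v} {v′} u≤ u′≤ = ≤-trans (+-mono-≤ u≤ u′≤) (≤-reflexive (interchange v c v′ c′))
      where
      interchange : ∀ a b d e → (a + b) + (d + e) ≡ (a + d) + (b + e)
      interchange = solve-∀

  ≈-cancelʳ : ∀ {z w c′} → x + z ≈[ c ] y + w → z ≈[ c′ ] w → x ≈[ c + c′ ] y
  ≈-cancelʳ {z} {w} {c′} (x+z≤ , y+w≤) (z≤ , w≤) = cancel x+z≤ w≤ , cancel y+w≤ z≤
    where
    cancel : ∀ {u v s t} → u + s ≤ (v + t) + c → t ≤ s + c′ → u ≤ v + (c + c′)
    cancel {u} {v} {s} {t} u+s≤ t≤ = +-cancelʳ-≤ s u (v + (c + c′)) (begin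
      u + s            ≤⟨ u+s≤ ⟩
      (v + t) + c      ≤⟨ +-monoˡ-≤ c (+-monoʳ-≤ v t≤) ⟩
      (v + (s + c′)) + c ≡⟨ shuffle v s c′ c ⟩
      (v + (c + c′)) + s ∎)
      where
      open ≤-Reasoning
      shuffle : ∀ a b d e → (a + (b + d)) + e ≡ (a + (e + d)) + b
      shuffle = solve-∀

  ≈⇒∣-∣≤ : x ≈[ c ] y → ∣ x - y ∣ ≤ c
  ≈⇒∣-∣≤ (x≤ , y≤) with ≤-total x y
  ... | inj₁ x≤y = subst (_≤ c) (sym (m≤n⇒∣m-n∣≡n∸m x≤y)) (m≤n+o⇒m∸n≤o y x y≤)
  ... | inj₂ y≤x = subst (_≤ c) (sym (m≤n⇒∣n-m∣≡n∸m y≤x)) (m≤n+o⇒m∸n≤o x y x≤)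

≤∧≤⇒≈ : ∀ {x y c} → x ≤ c → y ≤ c → x ≈[ c ] y
≤∧≤⇒≈ {x} {y} x≤c y≤c = ≤-trans x≤c (m≤n+m _ y) , ≤-trans y≤c (m≤n+m _ x)

sumBy-≈ : {f g c : A → ℕ} → (∀ x → f x ≈[ c x ] g x) →
          ∀ xs → sumBy f xs ≈[ sumBy c xs ] sumBy g xs
sumBy-≈ f≈g []       = z≤n , z≤n
sumBy-≈ f≈g (x ∷ xs) = +-≈ (f≈g x) (sumBy-≈ f≈g xs)

module _ {P : Pred ℕ ℓ} (P? : Decidable P) {e : ℕ} .{{_ : NonZero e}}
         (periodic : ∀ k → P (k + e) ⇔ P k) (one-per-period : countBelow P? e ≡ 1) where

  countBelow-+-period : ∀ n → countBelow P? (n + e) ≡ countBelow P? n + 1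
  countBelow-+-period zero    = one-per-period
  countBelow-+-period (suc n) = begin
    countBelow P? (suc (n + e))                        ≡⟨ countBelow-suc P? (n + e) ⟩
    countBelow P? (n + e) + indicator (P? (n + e))     ≡⟨ cong₂ _+_ (countBelow-+-period n)
                                                            (indicator-cong (P? (n + e)) (P? n) (periodic n)) ⟩
    (countBelow P? n + 1) + indicator (P? n)           ≡⟨ +-comm-last (countBelow P? n) 1 _ ⟩
    (countBelow P? n + indicator (P? n)) + 1           ≡⟨ cong (_+ 1) (countBelow-suc P? n) ⟨
    countBelow P? (suc n) + 1                          ∎
    where
    open ≡-Reasoning
    +-comm-last : ∀ a b c → (a + b) + c ≡ (a + c) + b
    +-comm-last = solve-∀

  countBelow-+-periods : ∀ r q → countBelow P? (r + q * e) ≡ countBelow P? r + q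
  countBelow-+-periods r zero    = trans (cong (countBelow P?) (+-identityʳ r)) (sym (+-identityʳ _))
  countBelow-+-periods r (suc q) = begin
    countBelow P? (r + (e + q * e))   ≡⟨ cong (countBelow P?) (shuffle r e (q * e)) ⟩
    countBelow P? ((r + q * e) + e)   ≡⟨ countBelow-+-period (r + q * e) ⟩
    countBelow P? (r + q * e) + 1     ≡⟨ cong (_+ 1) (countBelow-+-periods r q) ⟩
    (countBelow P? r + q) + 1         ≡⟨ +-suc-last (countBelow P? r) q ⟩
    countBelow P? r + suc q           ∎
    where
    open ≡-Reasoning
    shuffle : ∀ a b c → a + (b + c) ≡ (a + c) + b
    shuffle = solve-∀
    +-suc-last : ∀ a b → (a + b) + 1 ≡ a + suc b
    +-suc-last = solve-∀

  countBelow-≈ : ∀ n → e * countBelow P? n ≈[ e ] n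
  countBelow-≈ n = ≈-cong (sym e*countBelow[n]) (+-identityʳ e) (sym n≡r+qe) (+-≈ partial-period ≈-refl)
    where
    r q : ℕ
    r = n % e
    q = n / e
    n≡r+qe : n ≡ r + q * e
    n≡r+qe = m≡m%n+[m/n]*n n e
    e*countBelow[n] : e * countBelow P? n ≡ e * countBelow P? r + q * e
    e*countBelow[n] = begin
      e * countBelow P? n               ≡⟨ cong (λ m → e * countBelow P? m) n≡r+qe ⟩
      e * countBelow P? (r + q * e)     ≡⟨ cong (e *_) (countBelow-+-periods r q) ⟩
      e * (countBelow P? r + q)         ≡⟨ *-distribˡ-+ e (countBelow P? r) q ⟩
      e * countBelow P? r + e * q       ≡⟨ cong (e * countBelow P? r +_) (*-comm e q) ⟩
      e * countBelow P? r + q * e       ∎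
      where open ≡-Reasoning
    partial-period : e * countBelow P? r ≈[ e ] r
    partial-period = ≤∧≤⇒≈ (≤-trans (*-monoʳ-≤ e (subst (countBelow P? r ≤_) one-per-period
                                                   (countBelow-mono P? (<⇒≤ (m%n<n n e)))))
                                     (≤-reflexive (*-identityʳ e)))
                           (<⇒≤ (m%n<n n e))

open import Defs
open import Data.Nat.Divisibility as ℕ∣ using (_∣_; _∣?_; divides)
open import Data.Nat.GCD as ℕGCD using (gcd[m,n]∣m; gcd[m,n]∣n; gcd[m,n]≢0; n/gcd[m,n]≢0; gcd-greatest; gcd-GCD; module Bézout)
open import Data.Nat.Coprimality as Coprimality using (Coprime; coprime-/gcd; coprime-divisor; 1-coprimeTo)
open import Data.Nat.ListAction using (product)
open import Data.Nat.Primality using (Prime; prime?; prime⇒irreducible; prime⇒nonTrivial; prime⇒nonZero; productOfPrimes≢0)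
open import Data.Nat.Primality.Factorisation using (factorise)
open import Data.Integer as ℤ using (ℤ; +_; ∣_∣)
import Data.Integer.Properties as ℤP
open import Data.Integer.DivMod using (_/ℕ_; _%ℕ_; n%ℕd<d; a≡a%ℕn+[a/ℕn]*n)
open import Data.Integer.Divisibility.Signed as ℤ∣ using () renaming (_∣_ to _∣ℤ_; _∣?_ to _∣ℤ?_)
open import Data.Integer.GCD using (gcd)
import Data.Integer.Tactic.RingSolver as ℤ-Solver
open import Data.Rational as ℚ using (ℚ; mkℚ; 1ℚ; *≤*; Positive)
import Data.Rational.Properties as ℚP
open import Data.Rational.Solver using (module +-*-Solver)
open import Data.List.Relation.Unary.All as All using (All; []; _∷_)
open import Data.List.Relation.Unary.All.Properties using (all-filter)
open import Data.List.Relation.Unary.AllPairs using ([]; _∷_)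
open import Data.List.Relation.Unary.Unique.Propositional using (Unique)
import Data.List.Relation.Unary.Unique.Propositional.Properties as Unique
open import Data.List.Membership.Propositional using (_∈_)
open import Data.List.Membership.Propositional.Properties using (∈-filter⁺; ∈-upTo⁺)
open import Data.Vec using (Vec; []; _∷_)
open import Data.Vec.Relation.Unary.All using ([]; _∷_) renaming (All to Allᵛ)

module LinearCongruence (d : ℕ) .{{_ : NonZero d}} (a : ℤ) where

  g : ℕ
  g = ℕGCD.gcd ∣ a ∣ d

  instance
    g-nonZero : NonZero g
    g-nonZero = ℕ.≢-nonZero (gcd[m,n]≢0 ∣ a ∣ d (inj₂ (ℕ.≢-nonZero⁻¹ d)))

  e : ℕ
  e = d / g

  instance
    e-nonZero : NonZero e
    e-nonZero = ℕ.≢-nonZero (n/gcd[m,n]≢0 ∣ a ∣ d)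

  g*e≡d : g * e ≡ d
  g*e≡d = m*[n/m]≡n (gcd[m,n]∣n ∣ a ∣ d)

  g∣a : + g ∣ℤ a
  g∣a = ℤ∣.∣ᵤ⇒∣ (gcd[m,n]∣m ∣ a ∣ d)

  d∣a*e : + d ∣ℤ a ℤ.* + e
  d∣a*e = ℤ∣.∣ᵤ⇒∣ (subst₂ _∣_ g*e≡d (sym (ℤP.abs-* a (+ e))) (ℕ∣.*-monoˡ-∣ e (gcd[m,n]∣m ∣ a ∣ d)))

  a*u≡g-mod-d : ∃[ u ] + d ∣ℤ a ℤ.* u ℤ.- + g
  a*u≡g-mod-d with ℤ∣.m∣∣m∣ {a} | Bézout.identity (gcd-GCD ∣ a ∣ d)
  ... | ℤ∣.divides q ∣a∣≡qa | Bézout.+- x y g+yd≡x∣a∣ = q ℤ.* + x , ℤ∣.divides (+ y) (begin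
    a ℤ.* (q ℤ.* + x) ℤ.- + g     ≡⟨ reassoc a q (+ x) (+ g) ⟩
    + x ℤ.* (q ℤ.* a) ℤ.- + g     ≡⟨ cong (λ z → + x ℤ.* z ℤ.- + g) ∣a∣≡qa ⟨
    + x ℤ.* + ∣ a ∣ ℤ.- + g       ≡⟨ cong (ℤ._- + g) (trans (cong +_ g+yd≡x∣a∣) (ℤP.pos-* x ∣ a ∣)) ⟨
    + (g + y * d) ℤ.- + g         ≡⟨ cong (ℤ._- + g) (ℤP.pos-+ g (y * d)) ⟩
    + g ℤ.+ + (y * d) ℤ.- + g     ≡⟨ cancel (+ g) (+ (y * d)) ⟩
    + (y * d)                     ≡⟨ ℤP.pos-* y d ⟩
    + y ℤ.* + d                   ∎)
    where
    open ≡-Reasoning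
    reassoc : ∀ a q x g → a ℤ.* (q ℤ.* x) ℤ.- g ≡ x ℤ.* (q ℤ.* a) ℤ.- g
    reassoc = ℤ-Solver.solve-∀
    cancel : ∀ g z → g ℤ.+ z ℤ.- g ≡ z
    cancel = ℤ-Solver.solve-∀
  ... | ℤ∣.divides q ∣a∣≡qa | Bézout.-+ x y g+x∣a∣≡yd = ℤ.- (q ℤ.* + x) , ℤ∣.divides (ℤ.- + y) (begin
    a ℤ.* ℤ.- (q ℤ.* + x) ℤ.- + g   ≡⟨ reassoc a q (+ x) (+ g) ⟩
    ℤ.- (+ g ℤ.+ + x ℤ.* (q ℤ.* a)) ≡⟨ cong (λ z → ℤ.- (+ g ℤ.+ + x ℤ.* z)) ∣a∣≡qa ⟨
    ℤ.- (+ g ℤ.+ + x ℤ.* + ∣ a ∣)   ≡⟨ cong (λ z → ℤ.- (+ g ℤ.+ z)) (ℤP.pos-* x ∣ a ∣) ⟨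
    ℤ.- + (g + x * ∣ a ∣)           ≡⟨ cong (λ z → ℤ.- + z) g+x∣a∣≡yd ⟩
    ℤ.- + (y * d)                   ≡⟨ cong ℤ.-_ (ℤP.pos-* y d) ⟩
    ℤ.- (+ y ℤ.* + d)               ≡⟨ ℤP.neg-distribˡ-* (+ y) (+ d) ⟩
    ℤ.- + y ℤ.* + d                 ∎)
    where
    open ≡-Reasoning
    reassoc : ∀ a q x g → a ℤ.* ℤ.- (q ℤ.* x) ℤ.- g ≡ ℤ.- (g ℤ.+ x ℤ.* (q ℤ.* a))
    reassoc = ℤ-Solver.solve-∀

  module _ (s : ℤ) where

    Solves : ℤ → Set
    Solves i = + d ∣ℤ a ℤ.* i ℤ.+ s

    solves-shift : ∀ i j → Solves (i ℤ.+ j ℤ.* + e) ⇔ Solves i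
    solves-shift i j = mk⇔ (λ sol → ℤ∣.∣m+n∣n⇒∣m (subst (+ d ∣ℤ_) expand sol) d∣shift)
                           (λ sol → subst (+ d ∣ℤ_) (sym expand) (ℤ∣.∣m∣n⇒∣m+n sol d∣shift))
      where
      d∣shift : + d ∣ℤ j ℤ.* (a ℤ.* + e)
      d∣shift = ℤ∣.∣n⇒∣m*n j d∣a*e
      expand : a ℤ.* (i ℤ.+ j ℤ.* + e) ℤ.+ s ≡ (a ℤ.* i ℤ.+ s) ℤ.+ j ℤ.* (a ℤ.* + e)
      expand = distrib a i j (+ e) s
        where
        distrib : ∀ a i j e s → a ℤ.* (i ℤ.+ j ℤ.* e) ℤ.+ s ≡ (a ℤ.* i ℤ.+ s) ℤ.+ j ℤ.* (a ℤ.* e)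
        distrib = ℤ-Solver.solve-∀

    -- Solution k is about x = k + 1, so countBelow Solution? N counts the solutions in [1, N].
    Solution : ℕ → Set
    Solution k = Solves (+ suc k)

    Solution? : Decidable Solution
    Solution? k = + d ∣ℤ? a ℤ.* + suc k ℤ.+ s

    solution-periodic : ∀ k → Solution (k + e) ⇔ Solution k
    solution-periodic k = subst (λ i → Solves i ⇔ Solution k) +suc[k+e] (solves-shift (+ suc k) ℤ.1ℤ)
      where
      +suc[k+e] : + suc k ℤ.+ ℤ.1ℤ ℤ.* + e ≡ + suc (k + e)
      +suc[k+e] = cong (λ i → + suc k ℤ.+ i) (ℤP.*-identityˡ (+ e))

    solution⇒g∣s : ∀ {k} → Solution k → + g ∣ℤ s
    solution⇒g∣s {k} sol =
      ℤ∣.∣m+n∣m⇒∣n (ℤ∣.∣-trans (ℤ∣.∣ᵤ⇒∣ (gcd[m,n]∣n ∣ a ∣ d)) sol) (ℤ∣.∣m⇒∣m*n (+ suc k) g∣a)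

    solutions-congruent : ∀ {k t} → Solution k → Solution (k + t) → e ∣ t
    solutions-congruent {k} {t} sol sol′ =
      coprime-divisor (Coprimality.sym (coprime-/gcd ∣ a ∣ d))
        (ℕ∣.*-cancelʳ-∣ g (subst₂ _∣_ e*g≡d ∣a∣t≡ (ℤ∣.∣⇒∣ᵤ d∣at)))
      where
      d∣at : + d ∣ℤ a ℤ.* + t
      d∣at = ℤ∣.∣m+n∣m⇒∣n (subst (+ d ∣ℤ_) split sol′) sol
        where
        split : a ℤ.* + suc (k + t) ℤ.+ s ≡ (a ℤ.* + suc k ℤ.+ s) ℤ.+ a ℤ.* + t
        split = trans (cong (λ i → a ℤ.* i ℤ.+ s) (ℤP.pos-+ (suc k) t)) (rearrange a (+ suc k) (+ t) s)
          where
          rearrange : ∀ a i j s → a ℤ.* (i ℤ.+ j) ℤ.+ s ≡ (a ℤ.* i ℤ.+ s) ℤ.+ a ℤ.* j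
          rearrange = ℤ-Solver.solve-∀
      e*g≡d : d ≡ e * g
      e*g≡d = trans (sym g*e≡d) (*-comm g e)
      ∣a∣t≡ : ∣ a ℤ.* + t ∣ ≡ (∣ a ∣ / g) * t * g
      ∣a∣t≡ = begin
        ∣ a ℤ.* + t ∣             ≡⟨ ℤP.abs-* a (+ t) ⟩
        ∣ a ∣ * t                 ≡⟨ cong (_* t) (m/n*n≡m (gcd[m,n]∣m ∣ a ∣ d)) ⟨
        (∣ a ∣ / g) * g * t       ≡⟨ *-right-comm (∣ a ∣ / g) g t ⟩
        (∣ a ∣ / g) * t * g       ∎
        where
        open ≡-Reasoning
        *-right-comm : ∀ x y z → x * y * z ≡ x * z * y
        *-right-comm = solve-∀

    solution-gap : ∀ {k k′} → k ≤ k′ → k′ < e → Solution k → Solution k′ → k′ ≡ k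
    solution-gap {k} {k′} k≤k′ k′<e sol sol′ = begin
      k′             ≡⟨ m+[n∸m]≡n k≤k′ ⟨
      k + (k′ ∸ k)   ≡⟨ cong (_+_ k) (multiple-below e∣gap (≤-<-trans (m∸n≤m k′ k) k′<e)) ⟩
      k + 0          ≡⟨ +-identityʳ k ⟩
      k              ∎
      where
      open ≡-Reasoning
      e∣gap : e ∣ k′ ∸ k
      e∣gap = solutions-congruent sol (subst Solution (sym (m+[n∸m]≡n k≤k′)) sol′)
      multiple-below : ∀ {t} → e ∣ t → t < e → t ≡ 0
      multiple-below {zero}  _   _   = refl
      multiple-below {suc _} e∣t t<e = contradiction e∣t (ℕ∣.>⇒∤ t<e)

    solution-unique : ∀ {k k′} → k < e → k′ < e → Solution k → Solution k′ → k ≡ k′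
    solution-unique {k} {k′} k<e k′<e sol sol′ with ≤-total k k′
    ... | inj₁ k≤k′ = sym (solution-gap k≤k′ k′<e sol sol′)
    ... | inj₂ k′≤k = solution-gap k′≤k k<e sol′ sol

    solves-exists : + g ∣ℤ s → ∃ Solves
    solves-exists (ℤ∣.divides σ s≡σg) with a*u≡g-mod-d
    ... | u , d∣au-g = ℤ.- (σ ℤ.* u) ,
        subst (+ d ∣ℤ_) (sym (trans (cong (λ z → a ℤ.* ℤ.- (σ ℤ.* u) ℤ.+ z) s≡σg) (factor a σ u (+ g))))
              (ℤ∣.∣n⇒∣m*n (ℤ.- σ) d∣au-g)
      where
      factor : ∀ a σ u g → a ℤ.* ℤ.- (σ ℤ.* u) ℤ.+ σ ℤ.* g ≡ ℤ.- σ ℤ.* (a ℤ.* u ℤ.- g)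
      factor = ℤ-Solver.solve-∀

    solves⇒solution-below-e : ∀ i → Solves i → ∃[ r ] r < e × Solution r
    solves⇒solution-below-e i sol = r , n%ℕd<d (i ℤ.- ℤ.1ℤ) e ,
        subst Solves (sym +suc[r]≡i-je) (Equivalence.from (solves-shift i (ℤ.- j)) sol)
      where
      r : ℕ
      r = (i ℤ.- ℤ.1ℤ) %ℕ e
      j : ℤ
      j = (i ℤ.- ℤ.1ℤ) /ℕ e
      +suc[r]≡i-je : + suc r ≡ i ℤ.+ ℤ.- j ℤ.* + e
      +suc[r]≡i-je = begin
        ℤ.1ℤ ℤ.+ + r                               ≡⟨ add-and-subtract ℤ.1ℤ (+ r) (j ℤ.* + e) ⟩
        ℤ.1ℤ ℤ.+ (+ r ℤ.+ j ℤ.* + e) ℤ.- j ℤ.* + e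
          ≡⟨ cong (λ z → ℤ.1ℤ ℤ.+ z ℤ.- j ℤ.* + e) (a≡a%ℕn+[a/ℕn]*n (i ℤ.- ℤ.1ℤ) e) ⟨
        ℤ.1ℤ ℤ.+ (i ℤ.- ℤ.1ℤ) ℤ.- j ℤ.* + e        ≡⟨ simplify i j (+ e) ⟩
        i ℤ.+ ℤ.- j ℤ.* + e                        ∎
        where
        open ≡-Reasoning
        add-and-subtract : ∀ o r x → o ℤ.+ r ≡ o ℤ.+ (r ℤ.+ x) ℤ.- x
        add-and-subtract = ℤ-Solver.solve-∀
        simplify : ∀ i j e → ℤ.1ℤ ℤ.+ (i ℤ.- ℤ.1ℤ) ℤ.- j ℤ.* e ≡ i ℤ.+ ℤ.- j ℤ.* e
        simplify = ℤ-Solver.solve-∀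

    solution-exists : + g ∣ℤ s → ∃[ r ] r < e × Solution r
    solution-exists g∣s = solves⇒solution-below-e (proj₁ (solves-exists g∣s)) (proj₂ (solves-exists g∣s))

    solvable⇒countBelow-solutions-≈ : + g ∣ℤ s → ∀ N → d * countBelow Solution? N ≈[ d ] g * N
    solvable⇒countBelow-solutions-≈ g∣s N =
      ≈-cong (trans (sym (*-assoc g e C)) (cong (_* C) g*e≡d)) g*e≡d refl
             (*-≈ g (countBelow-≈ Solution? solution-periodic one-solution-per-period N))
      where
      C : ℕ
      C = countBelow Solution? N
      r : ℕ
      r = proj₁ (solution-exists g∣s)
      r<e : r < e
      r<e = proj₁ (proj₂ (solution-exists g∣s))
      sol : Solution r
      sol = proj₂ (proj₂ (solution-exists g∣s))
      one-solution-per-period : countBelow Solution? e ≡ 1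
      one-solution-per-period = countBelow-≡1 Solution? e r<e sol (λ k k<e sol′ → solution-unique k<e r<e sol′ sol)

    unsolvable⇒countBelow-solutions≡0 : ¬ (+ g ∣ℤ s) → ∀ N → countBelow Solution? N ≡ 0
    unsolvable⇒countBelow-solutions≡0 ¬g∣s N = countBelow-≡0 Solution? N (λ _ _ sol → ¬g∣s (solution⇒g∣s sol))

    countBelow-solutions-≈ : ∀ N → d * countBelow Solution? N ≈[ d ] g * N * indicator (+ g ∣ℤ? s)
    countBelow-solutions-≈ N = by-solvability (+ g ∣ℤ? s)
      where
      by-solvability : (g∣s? : Dec (+ g ∣ℤ s)) → d * countBelow Solution? N ≈[ d ] g * N * indicator g∣s?
      by-solvability (yes g∣s) = ≈-cong refl refl (sym (*-identityʳ (g * N))) (solvable⇒countBelow-solutions-≈ g∣s N)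
      by-solvability (no ¬g∣s) = ≈-cong (sym d*0≡0) refl (sym (*-zeroʳ (g * N))) ≈-refl
        where
        d*0≡0 : d * countBelow Solution? N ≡ 0
        d*0≡0 = trans (cong (d *_) (unsolvable⇒countBelow-solutions≡0 ¬g∣s N)) (*-zeroʳ d)

CoprimeTuple : ∀ {m} → Vec ℤ m → ℕ → Set
CoprimeTuple a d = ∀ {x} → Allᵛ (λ aᵢ → x ∣ ∣ aᵢ ∣) a → x ∣ d → x ≡ 1

-- discrepancy N m = m * N ^ (m ∸ 1)
discrepancy : ℕ → ℕ → ℕ
discrepancy N zero    = 0
discrepancy N (suc m) = N ^ m + N * discrepancy N m

discrepancy-≤ : ∀ N m → discrepancy N (suc m) ≤ (2 * N) ^ m
discrepancy-≤ N zero    = ≤-reflexive (cong suc (*-zeroʳ N))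
discrepancy-≤ N (suc m) = begin
  N ^ suc m + N * discrepancy N (suc m)   ≤⟨ +-mono-≤ (*-monoʳ-≤ N (^-monoˡ-≤ m N≤2N))
                                                      (*-monoʳ-≤ N (discrepancy-≤ N m)) ⟩
  N * (2 * N) ^ m + N * (2 * N) ^ m       ≡⟨ double N ((2 * N) ^ m) ⟩
  2 * N * (2 * N) ^ m                     ∎
  where
  open ≤-Reasoning
  double : ∀ n x → n * x + n * x ≡ 2 * n * x
  double = solve-∀
  N≤2N : N ≤ 2 * N
  N≤2N = m≤m+n N (N + 0)

module _ (N : ℕ) where

  sumBy-box : ∀ {m} (f : Vec ℤ (suc m) → ℕ) →
              sumBy f (box (suc m) N) ≡ sumBy (λ t → sumBy (λ k → f (+ suc k ∷ t)) (upTo N)) (box m N)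
  sumBy-box {m} f = begin
    sumBy f (concatMap (λ i → map (i ∷_) (box m N)) (map (λ k → + suc k) (upTo N)))
      ≡⟨ sumBy-concatMap f (λ i → map (i ∷_) (box m N)) (map (λ k → + suc k) (upTo N)) ⟩
    sumBy (λ i → sumBy f (map (i ∷_) (box m N))) (map (λ k → + suc k) (upTo N))
      ≡⟨ sumBy-map (λ i → sumBy f (map (i ∷_) (box m N))) (λ k → + suc k) (upTo N) ⟩
    sumBy (λ k → sumBy f (map (+ suc k ∷_) (box m N))) (upTo N)
      ≡⟨ sumBy-cong (λ k → sumBy-map f (+ suc k ∷_) (box m N)) (upTo N) ⟩
    sumBy (λ k → sumBy (λ t → f (+ suc k ∷ t)) (box m N)) (upTo N)
      ≡⟨ sumBy-comm (λ k t → f (+ suc k ∷ t)) (upTo N) (box m N) ⟩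
    sumBy (λ t → sumBy (λ k → f (+ suc k ∷ t)) (upTo N)) (box m N) ∎
    where open ≡-Reasoning

  sumBy-const-box : ∀ m c → sumBy (λ _ → c) (box m N) ≡ c * N ^ m
  sumBy-const-box zero    c = trans (+-identityʳ c) (sym (*-identityʳ c))
  sumBy-const-box (suc m) c = begin
    sumBy (λ _ → c) (box (suc m) N)                 ≡⟨ sumBy-box (λ _ → c) ⟩
    sumBy (λ _ → sumBy (λ _ → c) (upTo N)) (box m N) ≡⟨ cong (λ r → sumBy (λ _ → r) (box m N))
                                                          (trans (sumBy-const c (upTo N)) (cong (c *_) (length-upTo N))) ⟩
    sumBy (λ _ → c * N) (box m N)                   ≡⟨ sumBy-const-box m (c * N) ⟩
    c * N * N ^ m                                   ≡⟨ *-assoc c N (N ^ m) ⟩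
    c * N ^ suc m                                   ∎
    where open ≡-Reasoning

  divisibleCount : ∀ {m} → Vec ℤ m → ℕ → ℕ
  divisibleCount {m} a d = count (λ t → + d ∣ℤ? dot a t) (box m N)

  divisibleCount-≈ : ∀ {m} (a : Vec ℤ m) d .{{_ : NonZero d}} → CoprimeTuple a d →
                     N ^ m ≈[ d * discrepancy N m ] d * divisibleCount a d
  divisibleCount-≈ [] d coprime with coprime {d} [] ℕ∣.∣-refl
  ... | refl = ≈-refl
  divisibleCount-≈ {suc m} (a₁ ∷ a) d coprime =
    ≈-weaken error-bound (≈-trans (≈-cong refl refl (rearrange N g T) (*-≈ N induction-hypothesis)) (≈-sym by-rows))
    where
    open LinearCongruence d a₁ using (g; g-nonZero; Solution?; countBelow-solutions-≈)
    T : ℕ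
    T = divisibleCount a g
    B : ℕ
    B = discrepancy N m
    g∣d : g ∣ d
    g∣d = gcd[m,n]∣n ∣ a₁ ∣ d
    induction-hypothesis : N ^ m ≈[ g * B ] g * T
    induction-hypothesis = divisibleCount-≈ a g λ x∣a x∣g →
      coprime (ℕ∣.∣-trans x∣g (gcd[m,n]∣m ∣ a₁ ∣ d) ∷ x∣a) (ℕ∣.∣-trans x∣g g∣d)
    by-rows : d * divisibleCount (a₁ ∷ a) d ≈[ d * N ^ m ] g * N * T
    by-rows = ≈-cong (sym split) (sumBy-const-box m d) (sym (*-sumBy (g * N) _ (box m N)))
                (sumBy-≈ (λ t → countBelow-solutions-≈ (dot a t) N) (box m N))
      where
      split : d * divisibleCount (a₁ ∷ a) d ≡ sumBy (λ t → d * countBelow (Solution? (dot a t)) N) (box m N)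
      split = trans (cong (d *_) (sumBy-box (λ u → indicator (+ d ∣ℤ? dot (a₁ ∷ a) u)))) (*-sumBy d _ (box m N))
    rearrange : ∀ n g t → n * (g * t) ≡ g * n * t
    rearrange = solve-∀
    error-bound : N * (g * B) + d * N ^ m ≤ d * discrepancy N (suc m)
    error-bound = begin
      N * (g * B) + d * N ^ m   ≤⟨ +-monoˡ-≤ (d * N ^ m) (*-monoʳ-≤ N (*-monoˡ-≤ B (ℕ∣.∣⇒≤ g∣d))) ⟩
      N * (d * B) + d * N ^ m   ≡⟨ regroup N d B (N ^ m) ⟩
      d * (N ^ m + N * B)       ∎
      where
      open ≤-Reasoning
      regroup : ∀ n d b p → n * (d * b) + d * p ≡ d * (p + n * b)
      regroup = solve-∀

coprime⇒*-∣ : ∀ {m n k} → Coprime m n → m ∣ k → n ∣ k → m * n ∣ k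
coprime⇒*-∣ {m} {n} m⊥n (divides q refl) n∣qm = subst (m * n ∣_) (*-comm m q)
  (ℕ∣.*-monoʳ-∣ m (coprime-divisor (Coprimality.sym m⊥n) (subst (n ∣_) (*-comm q m) n∣qm)))

coprime-*ˡ : ∀ {m n k} → Coprime m k → Coprime n k → Coprime (m * n) k
coprime-*ˡ m⊥k n⊥k (i∣mn , i∣k) =
  n⊥k (coprime-divisor (λ (j∣i , j∣m) → m⊥k (j∣m , ℕ∣.∣-trans j∣i i∣k)) i∣mn , i∣k)

distinct-primes-coprime : ∀ {p q} → Prime p → Prime q → p ≢ q → Coprime p q
distinct-primes-coprime prime-p prime-q p≢q (i∣p , i∣q) with prime⇒irreducible prime-p i∣p
... | inj₁ i≡1 = i≡1
... | inj₂ refl with prime⇒irreducible prime-q i∣q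
...   | inj₁ p≡1 = contradiction p≡1 (ℕ.nonTrivial⇒≢1 {{prime⇒nonTrivial prime-p}})
...   | inj₂ p≡q = contradiction p≡q p≢q

Sifted : List ℕ → ℕ → ℤ → Set
Sifted P d x = + d ∣ℤ x × All (λ p → ¬ (+ p ∣ℤ x)) P

sifted? : ∀ P d x → Dec (Sifted P d x)
sifted? P d x = (+ d ∣ℤ? x) ×-dec All.all? (λ p → ¬? (+ p ∣ℤ? x)) P

module Sieve (xs : List ℤ) (D M B : ℕ)
  (equidistributed : ∀ d .{{_ : NonZero d}} → d ∣ D → M ≈[ d * B ] d * count (λ x → + d ∣ℤ? x) xs) where

  siftedCount : List ℕ → ℕ → ℕ
  siftedCount P d = count (sifted? P d) xs

  siftedCount-split : ∀ {d p} → Coprime d p → ∀ P →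
                      siftedCount P d ≡ siftedCount (p ∷ P) d + siftedCount P (d * p)
  siftedCount-split {d} {p} d⊥p P = trans (sumBy-cong split-at xs) (sumBy-+ _ _ xs)
    where
    split-at : ∀ x → indicator (sifted? P d x) ≡ indicator (sifted? (p ∷ P) d x) + indicator (sifted? P (d * p) x)
    split-at x = trans (indicator-split (sifted? P d x) (+ p ∣ℤ? x)) (cong₂ _+_
      (indicator-cong (sifted? P d x ×-dec ¬? (+ p ∣ℤ? x)) (sifted? (p ∷ P) d x) (not-divisible-by-p x))
      (indicator-cong (sifted? P d x ×-dec (+ p ∣ℤ? x)) (sifted? P (d * p) x) (divisible-by-p x)))
      where
      not-divisible-by-p : ∀ x → (Sifted P d x × ¬ (+ p ∣ℤ x)) ⇔ Sifted (p ∷ P) d x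
      not-divisible-by-p x = mk⇔ (λ ((d∣x , none) , p∤x) → d∣x , p∤x ∷ none)
                                 (λ { (d∣x , p∤x ∷ none) → (d∣x , none) , p∤x })
      divisible-by-p : ∀ x → (Sifted P d x × + p ∣ℤ x) ⇔ Sifted P (d * p) x
      divisible-by-p x = mk⇔ (λ ((d∣x , none) , p∣x) → ℤ∣.∣ᵤ⇒∣ (coprime⇒*-∣ d⊥p (ℤ∣.∣⇒∣ᵤ d∣x) (ℤ∣.∣⇒∣ᵤ p∣x)) , none)
                             (λ (dp∣x , none) → (ℤ∣.∣-trans (ℤ∣.∣ᵤ⇒∣ (ℕ∣.m∣m*n p)) dp∣x , none) ,
                                                ℤ∣.∣-trans (ℤ∣.∣ᵤ⇒∣ (ℕ∣.n∣m*n d)) dp∣x)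

  -- Multiplied through by d * ∏ P to stay in ℕ: siftedCount P d is M * ∏_{p ∈ P} (1 − 1/p) / d
  -- up to 2 ^ length P * B.
  siftedCount-≈ : ∀ P → All Prime P → Unique P → All (_∣ D) P →
                  ∀ d .{{_ : NonZero d}} → d ∣ D → All (Coprime d) P →
                  M * product (map pred P) ≈[ d * product P * (2 ^ length P * B) ] d * product P * siftedCount P d
  siftedCount-≈ [] _ _ _ d d∣D _ =
    ≈-cong (sym (*-identityʳ M)) (d*B≡ d B) (cong₂ _*_ (sym (*-identityʳ d)) (sumBy-cong unsifted xs))
      (equidistributed d d∣D)
    where
    unsifted : ∀ x → indicator (+ d ∣ℤ? x) ≡ indicator (sifted? [] d x)
    unsifted x = indicator-cong (+ d ∣ℤ? x) (sifted? [] d x) (mk⇔ (_, []) proj₁)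
    d*B≡ : ∀ d b → d * b ≡ d * 1 * (1 * b)
    d*B≡ = solve-∀
  siftedCount-≈ (p ∷ P) (prime-p ∷ primes) (p∉P ∷ unique) (p∣D ∷ divisors) d d∣D (d⊥p ∷ d⊥P) =
    ≈-cong (swap q M Φ) (double-error d p R (2 ^ length P) B) (reassoc d p R X)
      (≈-cancelʳ (≈-cong p*MF≡q*MF+MF refl (distrib p d R X Y) (*-≈ p sifted-at-d)) sifted-at-dp)
    where
    instance
      p-nonZero : NonZero p
      p-nonZero = prime⇒nonZero prime-p
      dp-nonZero : NonZero (d * p)
      dp-nonZero = m*n≢0 d p
    q = pred p
    Φ = product (map pred P)
    R = product P
    MF = M * Φ
    K = 2 ^ length P * B
    X = siftedCount (p ∷ P) d
    Y = siftedCount P (d * p)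
    p⊥P : All (Coprime p) P
    p⊥P = All.zipWith (uncurry (distinct-primes-coprime prime-p)) (primes , p∉P)
    sifted-at-d : MF ≈[ d * R * K ] d * R * (X + Y)
    sifted-at-d = ≈-cong refl refl (cong (d * R *_) (siftedCount-split d⊥p P))
                    (siftedCount-≈ P primes unique divisors d d∣D d⊥P)
    sifted-at-dp : MF ≈[ d * p * R * K ] d * p * R * Y
    sifted-at-dp = siftedCount-≈ P primes unique divisors (d * p) (coprime⇒*-∣ d⊥p d∣D p∣D)
                     (All.zipWith (uncurry coprime-*ˡ) (d⊥P , p⊥P))
    p*MF≡q*MF+MF : p * MF ≡ q * MF + MF
    p*MF≡q*MF+MF = trans (cong (_* MF) (sym (suc-pred p))) (+-comm MF (q * MF))
    swap : ∀ q m f → q * (m * f) ≡ m * (q * f)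
    swap = solve-∀
    distrib : ∀ p d r a y → p * (d * r * (a + y)) ≡ d * p * r * a + d * p * r * y
    distrib = solve-∀
    double-error : ∀ d p r x b → p * (d * r * (x * b)) + d * p * r * (x * b) ≡ d * (p * r) * (2 * x * b)
    double-error = solve-∀
    reassoc : ∀ d p r a → d * p * r * a ≡ d * (p * r) * a
    reassoc = solve-∀

open +-*-Solver using (solve; _:=_; _:+_; _:*_; _:-_; :-_; con)

toℚ≡mkℚ : ∀ n → toℚ n ≡ mkℚ (+ n) 0 (Coprimality.sym (1-coprimeTo n))
toℚ≡mkℚ n = ℚP.normalize-coprime (Coprimality.sym (1-coprimeTo n))

toℚ-+ : ∀ m n → toℚ (m + n) ≡ toℚ m ℚ.+ toℚ n
toℚ-+ m n = sym (begin
  toℚ m ℚ.+ toℚ n                 ≡⟨ cong₂ ℚ._+_ (toℚ≡mkℚ m) (toℚ≡mkℚ n) ⟩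
  (+ m ℤ.* + 1 ℤ.+ + n ℤ.* + 1) ℚ./ 1 ≡⟨ cong (ℚ._/ 1) (cong₂ ℤ._+_ (ℤP.*-identityʳ (+ m)) (ℤP.*-identityʳ (+ n))) ⟩
  toℚ (m + n)                     ∎)
  where open ≡-Reasoning

toℚ-* : ∀ m n → toℚ (m * n) ≡ toℚ m ℚ.* toℚ n
toℚ-* m n = sym (begin
  toℚ m ℚ.* toℚ n                 ≡⟨ cong₂ ℚ._*_ (toℚ≡mkℚ m) (toℚ≡mkℚ n) ⟩
  (+ m ℤ.* + n) ℚ./ 1             ≡⟨ cong (ℚ._/ 1) (ℤP.pos-* m n) ⟨
  toℚ (m * n)                     ∎)
  where open ≡-Reasoning

toℚ-mono-≤ : ∀ {m n} → m ≤ n → toℚ m ℚ.≤ toℚ n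
toℚ-mono-≤ {m} {n} m≤n = subst₂ ℚ._≤_ (sym (toℚ≡mkℚ m)) (sym (toℚ≡mkℚ n))
  (*≤* (subst₂ ℤ._≤_ (sym (ℤP.*-identityʳ (+ m))) (sym (ℤP.*-identityʳ (+ n))) (ℤ.+≤+ m≤n)))

toℚ-positive : ∀ n .{{_ : NonZero n}} → Positive (toℚ n)
toℚ-positive (suc n) = subst Positive (sym (toℚ≡mkℚ (suc n))) _

toℚ-∸ : ∀ {m n} → n ≤ m → toℚ m ℚ.- toℚ n ≡ toℚ (m ∸ n)
toℚ-∸ {m} {n} n≤m = begin
  toℚ m ℚ.- toℚ n                 ≡⟨ cong (λ k → toℚ k ℚ.- toℚ n) (m+[n∸m]≡n n≤m) ⟨
  toℚ (n + (m ∸ n)) ℚ.- toℚ n     ≡⟨ cong (ℚ._- toℚ n) (toℚ-+ n (m ∸ n)) ⟩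
  toℚ n ℚ.+ toℚ (m ∸ n) ℚ.- toℚ n ≡⟨ cancel (toℚ n) (toℚ (m ∸ n)) ⟩
  toℚ (m ∸ n)                     ∎
  where
  open ≡-Reasoning
  cancel : ∀ a b → a ℚ.+ b ℚ.- a ≡ b
  cancel = solve 2 (λ a b → a :+ b :- a := b) refl

∣toℚ∣ : ∀ n → ℚ.∣ toℚ n ∣ ≡ toℚ n
∣toℚ∣ n = ℚP.0≤p⇒∣p∣≡p (toℚ-mono-≤ {0} {n} z≤n)

∣toℚ-toℚ∣ : ∀ m n → ℚ.∣ toℚ m ℚ.- toℚ n ∣ ≡ toℚ ∣ m - n ∣
∣toℚ-toℚ∣ m n with ≤-total n m
... | inj₁ n≤m = begin
  ℚ.∣ toℚ m ℚ.- toℚ n ∣     ≡⟨ cong ℚ.∣_∣ (toℚ-∸ n≤m) ⟩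
  ℚ.∣ toℚ (m ∸ n) ∣         ≡⟨ ∣toℚ∣ (m ∸ n) ⟩
  toℚ (m ∸ n)               ≡⟨ cong toℚ (m≤n⇒∣n-m∣≡n∸m n≤m) ⟨
  toℚ ∣ m - n ∣             ∎
  where open ≡-Reasoning
... | inj₂ m≤n = begin
  ℚ.∣ toℚ m ℚ.- toℚ n ∣       ≡⟨ cong ℚ.∣_∣ (swap (toℚ m) (toℚ n)) ⟩
  ℚ.∣ ℚ.- (toℚ n ℚ.- toℚ m) ∣ ≡⟨ ℚP.∣-p∣≡∣p∣ (toℚ n ℚ.- toℚ m) ⟩
  ℚ.∣ toℚ n ℚ.- toℚ m ∣       ≡⟨ cong ℚ.∣_∣ (toℚ-∸ m≤n) ⟩
  ℚ.∣ toℚ (n ∸ m) ∣           ≡⟨ ∣toℚ∣ (n ∸ m) ⟩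
  toℚ (n ∸ m)                 ≡⟨ cong toℚ (m≤n⇒∣m-n∣≡n∸m m≤n) ⟨
  toℚ ∣ m - n ∣               ∎
  where
  open ≡-Reasoning
  swap : ∀ a b → a ℚ.- b ≡ ℚ.- (b ℚ.- a)
  swap = solve 2 (λ a b → a :- b := :- (b :- a)) refl

toℚ*recip≡1 : ∀ n → toℚ (suc n) ℚ.* recip (suc n) ≡ 1ℚ
toℚ*recip≡1 n = trans (cong₂ ℚ._*_ (toℚ≡mkℚ (suc n)) (ℚP.normalize-coprime (1-coprimeTo (suc n))))
                      (ℚP.*-inverseʳ (mkℚ (+ suc n) 0 (Coprimality.sym (1-coprimeTo (suc n)))))

toℚ*[1-recip]≡toℚ-pred : ∀ p → toℚ p ℚ.* (1ℚ ℚ.- recip p) ≡ toℚ (pred p)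
toℚ*[1-recip]≡toℚ-pred zero    = ℚP.*-zeroˡ (1ℚ ℚ.- recip zero)
toℚ*[1-recip]≡toℚ-pred (suc n) = begin
  toℚ (suc n) ℚ.* (1ℚ ℚ.- recip (suc n))          ≡⟨ distrib (toℚ (suc n)) (recip (suc n)) ⟩
  toℚ (suc n) ℚ.- toℚ (suc n) ℚ.* recip (suc n)   ≡⟨ cong₂ ℚ._-_ (toℚ-+ 1 n) (toℚ*recip≡1 n) ⟩
  (1ℚ ℚ.+ toℚ n) ℚ.- 1ℚ                           ≡⟨ cancel 1ℚ (toℚ n) ⟩
  toℚ n                                           ∎
  where
  open ≡-Reasoning
  distrib : ∀ x y → x ℚ.* (1ℚ ℚ.- y) ≡ x ℚ.- x ℚ.* y
  distrib = solve 2 (λ x y → x :* (con 1ℚ :- y) := x :- x :* y) refl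
  cancel : ∀ a b → a ℚ.+ b ℚ.- a ≡ b
  cancel = solve 2 (λ a b → a :+ b :- a := b) refl

toℚ-product*eulerFactors : ∀ L → toℚ (product L) ℚ.* foldr (λ p acc → (1ℚ ℚ.- recip p) ℚ.* acc) 1ℚ L
                                 ≡ toℚ (product (map pred L))
toℚ-product*eulerFactors []      = ℚP.*-identityʳ 1ℚ
toℚ-product*eulerFactors (p ∷ L) = begin
  toℚ (p * R) ℚ.* ((1ℚ ℚ.- recip p) ℚ.* F)         ≡⟨ cong (ℚ._* ((1ℚ ℚ.- recip p) ℚ.* F)) (toℚ-* p R) ⟩
  (toℚ p ℚ.* toℚ R) ℚ.* ((1ℚ ℚ.- recip p) ℚ.* F)   ≡⟨ interchange (toℚ p) (toℚ R) (1ℚ ℚ.- recip p) F ⟩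
  (toℚ p ℚ.* (1ℚ ℚ.- recip p)) ℚ.* (toℚ R ℚ.* F)   ≡⟨ cong₂ ℚ._*_ (toℚ*[1-recip]≡toℚ-pred p)
                                                                   (toℚ-product*eulerFactors L) ⟩
  toℚ (pred p) ℚ.* toℚ (product (map pred L))      ≡⟨ toℚ-* (pred p) _ ⟨
  toℚ (pred p * product (map pred L))              ∎
  where
  open ≡-Reasoning
  R = product L
  F = foldr (λ p acc → (1ℚ ℚ.- recip p) ℚ.* acc) 1ℚ L
  interchange : ∀ a b c d → (a ℚ.* b) ℚ.* (c ℚ.* d) ≡ (a ℚ.* c) ℚ.* (b ℚ.* d)
  interchange = solve 4 (λ a b c d → (a :* b) :* (c :* d) := (a :* c) :* (b :* d)) refl

rescaled-error-≤ : ∀ {R n M Φ c} (E : ℚ) .{{_ : NonZero R}} → toℚ R ℚ.* E ≡ toℚ Φ →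
                   R * n ≈[ R * c ] M * Φ → ℚ.∣ toℚ n ℚ.- toℚ M ℚ.* E ∣ ℚ.≤ toℚ c
rescaled-error-≤ {R} {n} {M} {Φ} {c} E RE≡Φ Rn≈MΦ = ℚP.*-cancelˡ-≤-pos (toℚ R) {{toℚ-positive R}} (begin
  toℚ R ℚ.* ℚ.∣ x ∣                    ≡⟨ cong (ℚ._* ℚ.∣ x ∣) (∣toℚ∣ R) ⟨
  ℚ.∣ toℚ R ∣ ℚ.* ℚ.∣ x ∣              ≡⟨ ℚP.∣p*q∣≡∣p∣*∣q∣ (toℚ R) x ⟨
  ℚ.∣ toℚ R ℚ.* x ∣                    ≡⟨ cong ℚ.∣_∣ scaled ⟩
  ℚ.∣ toℚ (R * n) ℚ.- toℚ (M * Φ) ∣    ≡⟨ ∣toℚ-toℚ∣ (R * n) (M * Φ) ⟩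
  toℚ ∣ R * n - M * Φ ∣                ≤⟨ toℚ-mono-≤ (≈⇒∣-∣≤ Rn≈MΦ) ⟩
  toℚ (R * c)                          ≡⟨ toℚ-* R c ⟩
  toℚ R ℚ.* toℚ c                      ∎)
  where
  open ℚP.≤-Reasoning
  x = toℚ n ℚ.- toℚ M ℚ.* E
  scaled : toℚ R ℚ.* x ≡ toℚ (R * n) ℚ.- toℚ (M * Φ)
  scaled = begin-equality
    toℚ R ℚ.* (toℚ n ℚ.- toℚ M ℚ.* E)            ≡⟨ distrib (toℚ R) (toℚ n) (toℚ M) E ⟩
    toℚ R ℚ.* toℚ n ℚ.- toℚ M ℚ.* (toℚ R ℚ.* E)  ≡⟨ cong₂ (λ u v → u ℚ.- toℚ M ℚ.* v) (sym (toℚ-* R n)) RE≡Φ ⟩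
    toℚ (R * n) ℚ.- toℚ M ℚ.* toℚ Φ              ≡⟨ cong (λ v → toℚ (R * n) ℚ.- v) (toℚ-* M Φ) ⟨
    toℚ (R * n) ℚ.- toℚ (M * Φ)                  ∎
    where
    distrib : ∀ r a b e → r ℚ.* (a ℚ.- b ℚ.* e) ≡ r ℚ.* a ℚ.- b ℚ.* (r ℚ.* e)
    distrib = solve 4 (λ r a b e → r :* (a :- b :* e) := r :* a :- b :* (r :* e)) refl

gcdAll-greatest : ∀ {m} (a : Vec ℤ m) d {x} → Allᵛ (λ aᵢ → x ∣ ∣ aᵢ ∣) a → x ∣ ∣ d ∣ → x ∣ ∣ gcdAll a d ∣
gcdAll-greatest []       d []            x∣d = x∣d
gcdAll-greatest (aᵢ ∷ a) d (x∣aᵢ ∷ x∣a) x∣d = gcd-greatest x∣aᵢ (gcdAll-greatest a d x∣a x∣d)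

gcdAll≡1⇒coprimeTuple : ∀ {m} (a : Vec ℤ m) D → gcdAll a (+ D) ≡ + 1 → CoprimeTuple a D
gcdAll≡1⇒coprimeTuple a D gcdAll≡1 {x} x∣a x∣D =
  ℕ∣.∣1⇒≡1 (subst (λ z → x ∣ ∣ z ∣) gcdAll≡1 (gcdAll-greatest a (+ D) x∣a x∣D))

prime-factor : ∀ n .{{_ : NonZero n}} → n ≢ 1 → ∃[ p ] Prime p × p ∣ n
prime-factor n n≢1 with factorise n
... | record { factors = [] ; isFactorisation = n≡1 } = contradiction n≡1 n≢1
... | record { factors = p ∷ ps ; isFactorisation = n≡p*ps ; factorsPrime = prime-p ∷ _ } =
  p , prime-p , subst (p ∣_) (sym n≡p*ps) (ℕ∣.m∣m*n (product ps))

module _ (D : ℕ) .{{_ : NonZero D}} where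

  isPrimeDivisor? = λ p → prime? p ×-dec p ∣? D

  primeDivisors-prime-divisors : All (λ p → Prime p × p ∣ D) (primeDivisors D)
  primeDivisors-prime-divisors = all-filter isPrimeDivisor? (upTo (suc D))

  primeDivisors-unique : Unique (primeDivisors D)
  primeDivisors-unique = Unique.filter⁺ isPrimeDivisor? (Unique.upTo⁺ (suc D))

  ∈-primeDivisors : ∀ {p} → Prime p → p ∣ D → p ∈ primeDivisors D
  ∈-primeDivisors prime-p p∣D = ∈-filter⁺ isPrimeDivisor? (∈-upTo⁺ (s≤s (ℕ∣.∣⇒≤ p∣D))) (prime-p , p∣D)

  coprime⇔sifted : ∀ x → gcd x (+ D) ≡ + 1 ⇔ Sifted (primeDivisors D) 1 x
  coprime⇔sifted x = mk⇔ to from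
    where
    to : gcd x (+ D) ≡ + 1 → Sifted (primeDivisors D) 1 x
    to gcd≡1 = ℤ∣.∣ᵤ⇒∣ (ℕ∣.1∣ _) , All.map (λ {p} (prime-p , p∣D) p∣x →
      ℕ.nonTrivial⇒≢1 {{prime⇒nonTrivial prime-p}}
        (ℕ∣.∣1⇒≡1 (subst (λ z → p ∣ ∣ z ∣) gcd≡1 (gcd-greatest (ℤ∣.∣⇒∣ᵤ p∣x) p∣D))))
      primeDivisors-prime-divisors
    from : Sifted (primeDivisors D) 1 x → gcd x (+ D) ≡ + 1
    from (_ , no-prime-divisor) with ℕGCD.gcd ∣ x ∣ D ℕ.≟ 1
    ... | yes g≡1 = cong +_ g≡1
    ... | no g≢1 = contradiction (ℤ∣.∣ᵤ⇒∣ (ℕ∣.∣-trans p∣g (gcd[m,n]∣m ∣ x ∣ D)))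
                     (All.lookup no-prime-divisor (∈-primeDivisors prime-p (ℕ∣.∣-trans p∣g (gcd[m,n]∣n ∣ x ∣ D))))
      where
      instance
        g-nonZero : NonZero (ℕGCD.gcd ∣ x ∣ D)
        g-nonZero = ℕ.≢-nonZero (gcd[m,n]≢0 ∣ x ∣ D (inj₂ (ℕ.≢-nonZero⁻¹ D)))
      p = proj₁ (prime-factor (ℕGCD.gcd ∣ x ∣ D) g≢1)
      prime-p = proj₁ (proj₂ (prime-factor (ℕGCD.gcd ∣ x ∣ D) g≢1))
      p∣g = proj₂ (proj₂ (prime-factor (ℕGCD.gcd ∣ x ∣ D) g≢1))

module _ (N D : ℕ) .{{_ : NonZero D}} {m} (a : Vec ℤ m) (gcdAll≡1 : gcdAll a (+ D) ≡ + 1) where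

  private
    L = primeDivisors D
    values = map (dot a) (box m N)

  equidistributed : ∀ d .{{_ : NonZero d}} → d ∣ D →
                    N ^ m ≈[ d * discrepancy N m ] d * count (λ x → + d ∣ℤ? x) values
  equidistributed d d∣D = ≈-cong refl refl (cong (d *_) (sym (sumBy-map _ (dot a) (box m N))))
    (divisibleCount-≈ N a d (λ x∣a x∣d → gcdAll≡1⇒coprimeTuple a D gcdAll≡1 x∣a (ℕ∣.∣-trans x∣d d∣D)))

  open Sieve values D (N ^ m) (discrepancy N m) equidistributed

  length-I≡siftedCount : length (I D N a) ≡ siftedCount L 1
  length-I≡siftedCount = begin
    length (I D N a)                                           ≡⟨ length-filter≡count _ (box m N) ⟩
    count (λ t → gcd (dot a t) (+ D) ℤ.≟ + 1) (box m N)        ≡⟨ sumBy-cong coprime≡sifted (box m N) ⟩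
    sumBy (λ t → indicator (sifted? L 1 (dot a t))) (box m N)  ≡⟨ sumBy-map _ (dot a) (box m N) ⟨
    siftedCount L 1                                            ∎
    where
    open ≡-Reasoning
    coprime≡sifted : ∀ t → indicator (gcd (dot a t) (+ D) ℤ.≟ + 1) ≡ indicator (sifted? L 1 (dot a t))
    coprime≡sifted t = indicator-cong _ _ (coprime⇔sifted D (dot a t))

  length-I-≈ : product L * length (I D N a) ≈[ product L * (2 ^ ω D * discrepancy N m) ] N ^ m * product (map pred L)
  length-I-≈ = ≈-sym (≈-cong refl (cong (_* (2 ^ ω D * discrepancy N m)) (*-identityˡ (product L)))
                              (cong₂ _*_ (*-identityˡ (product L)) (sym length-I≡siftedCount))
    (siftedCount-≈ L (All.map proj₁ (primeDivisors-prime-divisors D)) (primeDivisors-unique D)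
                   (All.map proj₂ (primeDivisors-prime-divisors D)) 1 (ℕ∣.1∣ D) (All.universal 1-coprimeTo L)))

lemmaA2 : (m D N : ℕ) → 0 < m → 0 < D → 0 < N → (a : Vec ℤ m) →
    gcdAll a (+ D) ≡ + 1 →
    ℚ.∣ toℚ (length (I D N a)) ℚ.- toℚ (N ^ m) ℚ.* eulerProduct D ∣
      ℚ.≤ toℚ (2 ^ ω D * (3 * N) ^ (m ∸ 1))
lemmaA2 (suc m) D N _ 0<D _ a gcdAll≡1 = begin
  ℚ.∣ toℚ (length (I D N a)) ℚ.- toℚ (N ^ suc m) ℚ.* eulerProduct D ∣
    ≤⟨ rescaled-error-≤ {R} {length (I D N a)} {N ^ suc m} {Φ} {2 ^ ω D * discrepancy N (suc m)} (eulerProduct D)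
                        (toℚ-product*eulerFactors (primeDivisors D)) (length-I-≈ N D a gcdAll≡1) ⟩
  toℚ (2 ^ ω D * discrepancy N (suc m))
    ≤⟨ toℚ-mono-≤ (*-monoʳ-≤ (2 ^ ω D) (≤-trans (discrepancy-≤ N m) (^-monoˡ-≤ m (*-monoˡ-≤ N (n≤1+n 2))))) ⟩
  toℚ (2 ^ ω D * (3 * N) ^ m)
    ∎
  where
  open ℚP.≤-Reasoning
  instance
    D-nonZero : NonZero D
    D-nonZero = ℕ.>-nonZero 0<D
  R = product (primeDivisors D)
  Φ = product (map pred (primeDivisors D))
  instance
    R-nonZero : NonZero R
    R-nonZero = productOfPrimes≢0 (All.map proj₁ (primeDivisors-prime-divisors D))
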